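{- During the execution of algorithm $\mathcal{D}^2\mathcal{I}$ on any input permutation, its last instruction (instruction 6: "otherwise perform $d_3$") can be executed only when the stack $D_2$ is empty.
   Context: The $\mathfrak{D}^2\mathfrak{I}$ machine: stacks $D_1,D_2$ (elements in decreasing order from top to bottom, top largest) followed by stack $I$ (elements in increasing order from top to bottom, top smallest). Operations: $d_0$: push next input element into $D_1$; $d_1$: pop $D_1$, push into $D_2$; $d_2$: pop $D_2$, push into $I$; $d_3$: pop $I$ and append to the output. An operation is legal if it respects the stack order restrictions. $Top(X)$ is the top element of stack $X$, and $Input$ is the next element of the input; any statement about an empty stack is considered true. Algorithm $\mathcal{D}^2\mathcal{I}$ repeatedly executes the first applicable instruction among: (1) if $Top(I)$ is the next element to be output, perform $d_3$; (2) if all elements contained in $D_1$ and $D_2$ are the next elements to be output, move them to the output; (3) perform $d_1$, provided $(\beta)$ holds; (4) perform $d_0$, provided $(\gamma)$ holds; (5) perform $d_2$, provided $(\alpha)$ holds; (6) otherwise perform $d_3$. Here $(\alpha)$: $Top(D_2)<Top(I)$; $(\beta)$: $Top(D_2)<Top(D_1)$ and $Top(D_1)<Top(I)$; $(\gamma)$: $Top(D_1)<Input$, $Input<Top(I)$, and the sequence of input elements from $Input$ up to the first input element larger than $Top(D_2)$ is increasing. Operations are only performed when legal. -}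

module Defs where

open import Data.Bool using (Bool; true; false; _∧_; _∨_; if_then_else_; not)
open import Data.Nat using (ℕ; zero; suc; _<ᵇ_; _≤ᵇ_)
open import Data.Nat.Properties using (≤-decTotalOrder)
open import Data.List.Base using (List; []; _∷_; _++_; applyUpTo)
open import Data.Maybe using (Maybe; just; nothing)
open import Data.Product using (_×_; _,_)
open import Data.List.Sort.MergeSort.Base ≤-decTotalOrder using (sort)

-- Elements of the permutation are natural numbers; the target output is
-- the increasing order.  All stacks are lists whose head is the top.
record State : Set where
  constructor mkState
  field
    input : List ℕ
    D₁    : List ℕ   -- head = Top(D₁); decreasing from top to bottom
    D₂    : List ℕ   -- head = Top(D₂); decreasing from top to bottom
    I     : List ℕ   -- head = Top(I);  increasing from top to bottom
    out   : List ℕ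
open State public

data Instr : Set where
  ins1 ins2 ins3 ins4 ins5 ins6 : Instr

allᵇ : (ℕ → Bool) → List ℕ → Bool
allᵇ p []       = true
allᵇ p (x ∷ xs) = p x ∧ allᵇ p xs

top : List ℕ → Maybe ℕ
top []      = nothing
top (x ∷ _) = just x

-- strict comparison where any statement about an empty stack
-- (represented by nothing) is true
_<ᴹ_ : Maybe ℕ → Maybe ℕ → Bool
nothing <ᴹ _       = true
just _  <ᴹ nothing = true
just a  <ᴹ just b  = a <ᵇ b

remaining : State → List ℕ
remaining s = input s ++ D₁ s ++ D₂ s ++ I s

-- x is the next element to be output: it is the smallest element not yet output
isNext : ℕ → State → Bool
isNext x s = allᵇ (λ y → x ≤ᵇ y) (remaining s)

isNonEmpty : List ℕ → Bool
isNonEmpty []      = false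
isNonEmpty (_ ∷ _) = true

-- the elements of D₁ and D₂ are (all of) the next elements to be output:
-- D₁ ∪ D₂ is non-empty and each of its elements is smaller than every other
-- element not yet output (those in the input and in I)
nextAreD₁D₂ : State → Bool
nextAreD₁D₂ s =
  isNonEmpty (D₁ s ++ D₂ s)
  ∧ allᵇ (λ x → allᵇ (λ y → x <ᵇ y) (input s ++ I s)) (D₁ s ++ D₂ s)

-- the input elements from Input up to (and including) the first input
-- element larger than Top(D₂); if D₂ is empty this is just Input
segment : Maybe ℕ → List ℕ → List ℕ
segment _        []       = []
segment nothing  (x ∷ _)  = x ∷ []
segment (just t) (x ∷ xs) = if t <ᵇ x then x ∷ [] else x ∷ segment (just t) xs

increasing : List ℕ → Bool
increasing []           = true
increasing (x ∷ [])     = true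
increasing (x ∷ y ∷ ys) = (x <ᵇ y) ∧ increasing (y ∷ ys)

condα : State → Bool
condα s = top (D₂ s) <ᴹ top (I s)

condβ : State → Bool
condβ s = (top (D₂ s) <ᴹ top (D₁ s)) ∧ (top (D₁ s) <ᴹ top (I s))

condγ : State → Bool
condγ s = (top (D₁ s) <ᴹ top (input s)) ∧ (top (input s) <ᴹ top (I s))
          ∧ increasing (segment (top (D₂ s)) (input s))

-- the machine operations (only applied when legal; the popped stack is non-empty)
opd₀ opd₁ opd₂ opd₃ : State → State
opd₀ (mkState (x ∷ xs) d1 d2 i o) = (mkState xs (x ∷ d1) d2 i o)
opd₀ s = s
opd₁ (mkState xs (x ∷ d1) d2 i o) = (mkState xs d1 (x ∷ d2) i o)
opd₁ s = s
opd₂ (mkState xs d1 (x ∷ d2) i o) = (mkState xs d1 d2 (x ∷ i) o)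
opd₂ s = s
opd₃ (mkState xs d1 d2 (x ∷ i) o) = (mkState xs d1 d2 i (o ++ (x ∷ [])))
opd₃ s = s

flushD : State → State
flushD (mkState xs d1 d2 i o) = (mkState xs [] [] i (o ++ sort (d1 ++ d2)))

-- legality of the operations (besides the order conditions, which are
-- implied by (β), (γ), (α) respectively): the popped stack is non-empty
canD₀ canD₁ canD₂ canD₃ : State → Bool
canD₀ s = isNonEmpty (input s)
canD₁ s = isNonEmpty (D₁ s)
canD₂ s = isNonEmpty (D₂ s)
canD₃ s = isNonEmpty (I s)

finished : State → Bool
finished s = not (isNonEmpty (remaining s))

topIisNext : State → Bool
topIisNext (mkState _ _ _ [] _) = false
topIisNext s@(mkState _ _ _ (x ∷ _) _) = isNext x s

-- Returns nothing if the algorithm has terminated (all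
-- elements output) or is stuck (instruction 6 would pop an empty I).
stepD²I : State → Maybe (Instr × State)
stepD²I s =
  if finished s then nothing else
  if topIisNext s then just (ins1 , opd₃ s) else
  if nextAreD₁D₂ s then just (ins2 , flushD s) else
  if canD₁ s ∧ condβ s then just (ins3 , opd₁ s) else
  if canD₀ s ∧ condγ s then just (ins4 , opd₀ s) else
  if canD₂ s ∧ condα s then just (ins5 , opd₂ s) else
  if canD₃ s then just (ins6 , opd₃ s) else nothing

initial : List ℕ → State
initial π = (mkState π [] [] [] [])

runD²I : ℕ → State → Maybe State
runD²I zero    s = just s
runD²I (suc k) s with stepD²I s
... | nothing       = nothing
... | just (_ , s') = runD²I k s'

oneTo : ℕ → List ℕ
oneTo n = applyUpTo suc n

module Submission where

-- Instruction 6 of D²I is reached only after instruction 5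
-- ("d₂ if (α)") was not applicable, i.e. D₂ is empty or (α) fails.  So it
-- suffices to show that (α), Top(D₂) < Top(I), holds in every reachable
-- state.  It follows from this invariant of the algorithm:
--   (α) holds,  D₂ is decreasing from the top,  I is increasing from the top.
-- Each machine operation, applied as the algorithm applies it, preserves it:
-- d₀ and instruction 2 do not disturb it, d₁ is guarded by (β), d₂ pushes
-- onto I an element smaller than Top(I) and exposes a smaller Top(D₂), and
-- d₃ exposes a larger Top(I).  The invariant holds trivially initially, so it
-- holds after any number of steps.

open import Defs
open import Data.Nat using (ℕ; zero; suc; _<ᵇ_)
open import Data.Nat.Properties using (<ᵇ⇒<; <⇒<ᵇ; <-trans)
open import Data.Bool using (Bool; true; false; _∧_; T)
open import Data.Bool.Properties using (T-∧; T-≡)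
open import Data.List using (List; []; _∷_)
open import Data.Maybe using (just; nothing)
open import Data.Product using (_,_; proj₁; proj₂)
open import Data.Unit using (tt)
open import Data.Empty using (⊥-elim)
open import Function.Bundles using (Equivalence)
open import Relation.Nullary using (contradiction)
open import Relation.Binary.PropositionalEquality using (_≡_; _≢_; refl; subst)
open import Data.List.Relation.Binary.Permutation.Propositional using (_↭_)

decreasing : List ℕ → Bool
decreasing []           = true
decreasing (x ∷ [])     = true
decreasing (x ∷ y ∷ ys) = (y <ᵇ x) ∧ decreasing (y ∷ ys)

∧-left : ∀ {a b} → T (a ∧ b) → T a
∧-left p = proj₁ (Equivalence.to T-∧ p)

∧-right : ∀ {a b} → T (a ∧ b) → T b
∧-right p = proj₂ (Equivalence.to T-∧ p)

<ᴹ-trans-just : ∀ a x b → T (a <ᴹ just x) → T (just x <ᴹ b) → T (a <ᴹ b)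
<ᴹ-trans-just nothing  x b        _ _ = tt
<ᴹ-trans-just (just a) x nothing  _ _ = tt
<ᴹ-trans-just (just a) x (just b) p q =
  <⇒<ᵇ (<-trans (<ᵇ⇒< a x p) (<ᵇ⇒< x b q))

decreasing-head : ∀ x d → T (decreasing (x ∷ d)) → T (top d <ᴹ just x)
decreasing-head x []      _ = tt
decreasing-head x (y ∷ d) p = ∧-left p

decreasing-tail : ∀ x d → T (decreasing (x ∷ d)) → T (decreasing d)
decreasing-tail x []      _ = tt
decreasing-tail x (y ∷ d) p = ∧-right p

decreasing-push : ∀ x d → T (top d <ᴹ just x) → T (decreasing d) → T (decreasing (x ∷ d))
decreasing-push x []      _ _ = tt
decreasing-push x (y ∷ d) p q = Equivalence.from T-∧ (p , q)

increasing-head : ∀ x i → T (increasing (x ∷ i)) → T (just x <ᴹ top i)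
increasing-head x []      _ = tt
increasing-head x (y ∷ i) p = ∧-left p

increasing-tail : ∀ x i → T (increasing (x ∷ i)) → T (increasing i)
increasing-tail x []      _ = tt
increasing-tail x (y ∷ i) p = ∧-right p

increasing-push : ∀ x i → T (just x <ᴹ top i) → T (increasing i) → T (increasing (x ∷ i))
increasing-push x []      _ _ = tt
increasing-push x (y ∷ i) p q = Equivalence.from T-∧ (p , q)

record Sound (s : State) : Set where
  constructor sound
  field
    α-holds       : T (condα s)
    D₂-decreasing : T (decreasing (D₂ s))
    I-increasing  : T (increasing (I s))
open Sound

initial-sound : ∀ π → Sound (initial π)
initial-sound π = sound tt tt tt

-- d₃ exposes the element below Top(I), which is larger than Top(I).
sound-d₃ : ∀ s → Sound s → Sound (opd₃ s)
sound-d₃ (mkState xs d1 d2 []      o) v = v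
sound-d₃ (mkState xs d1 d2 (x ∷ i) o) (sound α dd ii) =
  sound (<ᴹ-trans-just (top d2) x (top i) α (increasing-head x i ii)) dd (increasing-tail x i ii)

-- d₂ moves Top(D₂) < Top(I) onto I and exposes a smaller Top(D₂).
sound-d₂ : ∀ s → Sound s → Sound (opd₂ s)
sound-d₂ (mkState xs d1 []       i o) v = v
sound-d₂ (mkState xs d1 (x ∷ d2) i o) (sound α dd ii) =
  sound (decreasing-head x d2 dd) (decreasing-tail x d2 dd) (increasing-push x i α ii)

-- d₁ under (β): Top(D₂) < Top(D₁) < Top(I), so Top(D₁) fits between them.
sound-d₁ : ∀ s → Sound s → T (condβ s) → Sound (opd₁ s)
sound-d₁ (mkState xs []       d2 i o) v _ = v
sound-d₁ (mkState xs (x ∷ d1) d2 i o) (sound α dd ii) β =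
  sound (∧-right β) (decreasing-push x d2 (∧-left β) dd) ii

sound-d₀ : ∀ s → Sound s → Sound (opd₀ s)
sound-d₀ (mkState []       d1 d2 i o) v = v
sound-d₀ (mkState (x ∷ xs) d1 d2 i o) (sound α dd ii) = sound α dd ii

sound-flush : ∀ s → Sound s → Sound (flushD s)
sound-flush (mkState xs d1 d2 i o) v = sound tt tt (I-increasing v)

instr-mismatch : ∀ {A : Set} {j : Instr} {t t' : State} → just (j , t) ≡ just (ins6 , t') → j ≢ ins6 → A
instr-mismatch refl j≢ins6 = contradiction refl j≢ins6

same-state : ∀ {j j' : Instr} {t t' : State} → just (j , t) ≡ just (j' , t') → t ≡ t'
same-state refl = refl

no-step : ∀ {A B : Set} {b : B} → nothing ≡ just b → A
no-step ()

step-sound : ∀ {s j s'} → Sound s → stepD²I s ≡ just (j , s') → Sound s'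
step-sound {s} v eq with finished s
... | true = no-step eq
... | false with topIisNext s
...   | true = subst Sound (same-state eq) (sound-d₃ s v)
...   | false with nextAreD₁D₂ s
...     | true = subst Sound (same-state eq) (sound-flush s v)
...     | false with canD₁ s ∧ condβ s in guard₃
...       | true = subst Sound (same-state eq)
                     (sound-d₁ s v (∧-right {canD₁ s} (Equivalence.from T-≡ guard₃)))
...       | false with canD₀ s ∧ condγ s
...         | true = subst Sound (same-state eq) (sound-d₀ s v)
...         | false with canD₂ s ∧ condα s
...           | true = subst Sound (same-state eq) (sound-d₂ s v)
...           | false with canD₃ s
...             | true = subst Sound (same-state eq) (sound-d₃ s v)
...             | false = no-step eq

run-preserves : (P : State → Set) →
  (∀ {s j s'} → P s → stepD²I s ≡ just (j , s') → P s') →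
  ∀ k {s t} → P s → runD²I k s ≡ just t → P t
run-preserves P step zero    p refl = p
run-preserves P step (suc k) {s} p eq with stepD²I s in e
... | nothing       = no-step eq
... | just (_ , s') = run-preserves P step k (step p e) eq

-- When instruction 6 is executed, the guard of instruction 5 has failed
-- (in the last clause the goal has been abstracted to false ≡ false).
ins6-guard : ∀ s {s'} → stepD²I s ≡ just (ins6 , s') → canD₂ s ∧ condα s ≡ false
ins6-guard s eq with finished s
... | true = no-step eq
... | false with topIisNext s
...   | true = instr-mismatch eq λ ()
...   | false with nextAreD₁D₂ s
...     | true = instr-mismatch eq λ ()
...     | false with canD₁ s ∧ condβ s
...       | true = instr-mismatch eq λ ()
...       | false with canD₀ s ∧ condγ s
...         | true = instr-mismatch eq λ ()
...         | false with canD₂ s ∧ condα s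
...           | true = instr-mismatch eq λ ()
...           | false = refl

α-and-no-d₂⇒D₂-empty : ∀ s → T (condα s) → canD₂ s ∧ condα s ≡ false → D₂ s ≡ []
α-and-no-d₂⇒D₂-empty (mkState xs d1 []       i o) _ _ = refl
α-and-no-d₂⇒D₂-empty (mkState xs d1 (x ∷ d2) i o) α fails = ⊥-elim (subst T fails α)

corollary2 : (n : ℕ) (π : List ℕ) → π ↭ oneTo n →
    (k : ℕ) (s s' : State) → runD²I k (initial π) ≡ just s →
    stepD²I s ≡ just (ins6 , s') → D₂ s ≡ []
corollary2 n π _ k s s' run ins6-step =
  α-and-no-d₂⇒D₂-empty s (α-holds reachable-sound) (ins6-guard s ins6-step)
  where
  reachable-sound : Sound s
  reachable-sound = run-preserves Sound step-sound k (initial-sound π) run
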